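{- For any $M,N,k\in\mathbb{N}$ with $M<N$, \[ 0\leq N-M+1-\sum_{n=M}^{N}\frac{\varphi(k,n)}{n}\leq\frac{N-M}{k}+\log N, \] where $\varphi(k,n)=\#\{m\in\mathbb{N}:1\leq m\leq n,\ \gcd(m,n)\leq k\}$. -}

module Defs where

open import Data.Nat as ℕ using (ℕ; zero; suc; _∸_; _≤?_)
open import Data.Nat.GCD using (gcd)
open import Data.Integer using (+_)
open import Data.List using (List; length; filter; map; upTo; foldr)
open import Data.Rational using (ℚ; 0ℚ; 1ℚ; _+_; _-_; _*_; _/_; _≤_; _<_)
open import Data.Product using (∃-syntax)

φ : ℕ → ℕ → ℕ
φ k n = length (filter (λ m → gcd m n ≤? k) (map suc (upTo n)))

-- a / b as a rational, for natural numbers a, b; (junk value 0 when b = 0,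
-- never used: the statement only divides by positive numbers)
_/ℕ_ : ℕ → ℕ → ℚ
a /ℕ zero = 0ℚ
a /ℕ suc b = (+ a) / suc b

ℕ→ℚ : ℕ → ℚ
ℕ→ℚ n = (+ n) / 1

sumℚ : List ℚ → ℚ
sumℚ = foldr _+_ 0ℚ

phiSum : ℕ → ℕ → ℕ → ℚ
phiSum k M N = sumℚ (map (λ n → φ k n /ℕ n) (map (M ℕ.+_) (upTo (suc (N ∸ M)))))

_^ℚ_ : ℚ → ℕ → ℚ
x ^ℚ zero = 1ℚ
x ^ℚ suc j = x * (x ^ℚ j)

-- partial sums of the series log N = Σ_{j ≥ 1} (1 - 1/N)^j / j   (N ≥ 1)
logPartial : ℕ → ℕ → ℚ
logPartial N J =
  sumℚ (map (λ i → ((1ℚ - (1 /ℕ N)) ^ℚ suc i) * (1 /ℕ suc i)) (upTo J))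

-- q ≤ log N  (for N ≥ 1): the partial sums increase to log N, so this
-- holds iff for every rational ε > 0 some partial sum is ≥ q - ε.
_≤log_ : ℚ → ℕ → Set
q ≤log N = (ε : ℚ) → 0ℚ < ε → ∃[ J ] (q - ε ≤ logPartial N J)

-- The quantity N - M + 1 - Σ φ(k,n)/n is the sum over M ≤ n ≤ N of the deficits
-- 1 - φ(k,n)/n = (n - φ(k,n))/n, hence nonnegative.  An m ≤ n with gcd(m,n) > k is a
-- multiple of a common divisor d ∈ (k, N] of m and n, and for d ∣ n there are n/d
-- such m; so the deficit of n is at most Σ_{k<d≤N, d∣n} 1/d.  Exchanging the sums,
-- d divides at most (N-M)/d + 1 of the n ∈ [M, N], which gives the bound
-- (N-M) Σ_{d>k} 1/d² + Σ_{d=2}^N 1/d ≤ (N-M)/k + Σ_{d=2}^N 1/d, by telescoping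
-- 1/d² ≤ 1/(d-1) - 1/d.  Finally Bernoulli's inequality (1 - 1/N)^j ≥ 1 - j/N
-- bounds the j-th term of log N = Σ_j (1 - 1/N)^j / j below by 1/j - 1/N, and the
-- first N - 1 of these lower bounds add up to exactly Σ_{d=2}^N 1/d.
module Submission where

open import Data.List.Base using (List; []; _∷_; _++_; [_]; map; length; filter; upTo; applyUpTo)
open import Data.List.Membership.Propositional using (_∈_)
open import Data.List.Properties using (map-upTo; map-++; map-∘; length-filter; length-map; length-upTo)
open import Data.List.Relation.Unary.All as All using (All)
open import Data.List.Relation.Unary.Any using (here; there)
open import Data.Nat.Divisibility using (_∣_; _∣?_; divides)
open import Data.Nat.ListAction using (sum)
open import Data.Nat.ListAction.Properties using (sum-++)
open import Data.Nat.Solver renaming (module +-*-Solver to ℕ-Solver)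
open import Data.Product.Base using (_×_; _,_; proj₁; proj₂; ∃-syntax)
open import Function.Base using (_∘_)
open import Relation.Binary.PropositionalEquality
  using (_≡_; refl; sym; trans; cong; cong₂; subst; subst₂; module ≡-Reasoning)
open import Relation.Nullary using (Dec; yes; no; ¬_)
open import Relation.Nullary.Decidable using (_×-dec_)
open import Relation.Unary using (Decidable; _⊆_)
open import Defs

module Counting where

  open import Data.Empty using (⊥-elim)
  open import Data.Nat.Base
    using (ℕ; zero; suc; _+_; _*_; _∸_; _≤_; _<_; z≤n; s≤s; z<s; NonZero; >-nonZero⁻¹)
  open import Data.Nat.GCD using (gcd; gcd[m,n]∣m; gcd[m,n]∣n; gcd[m,n]≤n)
  open import Data.Nat.Properties

  range : ℕ → ℕ → List ℕ
  range a zero    = []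
  range a (suc L) = a ∷ range (suc a) L

  applyUpTo≡range : ∀ {f : ℕ → ℕ} a L → (∀ i → f i ≡ a + i) → applyUpTo f L ≡ range a L
  applyUpTo≡range a zero    f≗a+ = refl
  applyUpTo≡range a (suc L) f≗a+ =
    cong₂ _∷_ (trans (f≗a+ 0) (+-identityʳ a))
              (applyUpTo≡range (suc a) L (λ i → trans (f≗a+ (suc i)) (+-suc a i)))

  map-+-upTo : ∀ a L → map (a +_) (upTo L) ≡ range a L
  map-+-upTo a L = trans (map-upTo (a +_) L) (applyUpTo≡range a L (λ _ → refl))

  length-range : ∀ a L → length (range a L) ≡ L
  length-range a zero    = refl
  length-range a (suc L) = cong suc (length-range (suc a) L)

  range-++ : ∀ a L L′ → range a (L + L′) ≡ range a L ++ range (a + L) L′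
  range-++ a zero    L′ = cong (λ b → range b L′) (sym (+-identityʳ a))
  range-++ a (suc L) L′ = cong (a ∷_) (trans (range-++ (suc a) L L′)
    (cong (λ b → range (suc a) L ++ range b L′) (sym (+-suc a L))))

  range-∷ʳ : ∀ a L → range a (suc L) ≡ range a L ++ [ a + L ]
  range-∷ʳ a L = trans (cong (range a) (+-comm 1 L)) (range-++ a L 1)

  ∈-range⁺ : ∀ {a L x} → a ≤ x → x < a + L → x ∈ range a L
  ∈-range⁺ {a} {zero}  a≤x x<a+0 = ⊥-elim (<⇒≱ x<a+0 (subst (_≤ _) (sym (+-identityʳ a)) a≤x))
  ∈-range⁺ {a} {suc L} {x} a≤x x<a+L with a ≟ x
  ... | yes refl = here refl
  ... | no  a≢x  = there (∈-range⁺ (≤∧≢⇒< a≤x a≢x) (subst (x <_) (+-suc a L) x<a+L))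

  range-∸-split : ∀ {a b c} → a ≤ b → b ≤ c → range a (c ∸ a) ≡ range a (b ∸ a) ++ range b (c ∸ b)
  range-∸-split {a} {b} {c} a≤b b≤c = begin
    range a (c ∸ a)                                 ≡⟨ cong (λ c → range a (c ∸ a)) (m∸n+n≡m b≤c) ⟨
    range a ((c ∸ b + b) ∸ a)                       ≡⟨ cong (range a) (+-∸-assoc (c ∸ b) a≤b) ⟩
    range a (c ∸ b + (b ∸ a))                       ≡⟨ cong (range a) (+-comm (c ∸ b) (b ∸ a)) ⟩
    range a (b ∸ a + (c ∸ b))                       ≡⟨ range-++ a (b ∸ a) (c ∸ b) ⟩
    range a (b ∸ a) ++ range (a + (b ∸ a)) (c ∸ b)  ≡⟨ cong (λ b′ → range a (b ∸ a) ++ range b′ (c ∸ b))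
                                                             (m+[n∸m]≡n a≤b) ⟩
    range a (b ∸ a) ++ range b (c ∸ b)              ∎
    where open ≡-Reasoning

  All-range : ∀ {P : ℕ → Set} a L → (∀ x → a ≤ x → x < a + L → P x) → All P (range a L)
  All-range a zero    h = All.[]
  All-range a (suc L) h = h a ≤-refl (m<m+n a z<s) All.∷
    All-range (suc a) L (λ x a<x x<1+a+L → h x (<⇒≤ a<x) (subst (x <_) (sym (+-suc a L)) x<1+a+L))

  indicator : ∀ {A : Set} → Dec A → ℕ
  indicator (yes _) = 1
  indicator (no  _) = 0

  1≤indicator : ∀ {A : Set} (A? : Dec A) → A → 1 ≤ indicator A?
  1≤indicator (yes _) _  = ≤-refl
  1≤indicator (no ¬a) a = ⊥-elim (¬a a)

  sum-map-+ : ∀ {A : Set} (f g : A → ℕ) xs →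
              sum (map (λ x → f x + g x) xs) ≡ sum (map f xs) + sum (map g xs)
  sum-map-+ f g []       = refl
  sum-map-+ f g (x ∷ xs) = trans (cong ((f x + g x) +_) (sum-map-+ f g xs))
    (solve 4 (λ a b c d → (a :+ b) :+ (c :+ d) := (a :+ c) :+ (b :+ d)) refl
             (f x) (g x) (sum (map f xs)) (sum (map g xs)))
    where open ℕ-Solver

  ∈⇒≤sum-map : ∀ {A : Set} (f : A → ℕ) {x xs} → x ∈ xs → f x ≤ sum (map f xs)
  ∈⇒≤sum-map f {xs = y ∷ ys} (here refl) = m≤m+n (f y) _
  ∈⇒≤sum-map f {xs = y ∷ ys} (there x∈) = ≤-trans (∈⇒≤sum-map f x∈) (m≤n+m _ (f y))

  module _ {A : Set} {P : A → Set} (P? : Decidable P) where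

    count : List A → ℕ
    count xs = sum (map (λ x → indicator (P? x)) xs)

    length-filter≡count : ∀ xs → length (filter P? xs) ≡ count xs
    length-filter≡count []       = refl
    length-filter≡count (x ∷ xs) with P? x
    ... | yes _ = cong suc (length-filter≡count xs)
    ... | no  _ = length-filter≡count xs

    count-++ : ∀ xs ys → count (xs ++ ys) ≡ count xs + count ys
    count-++ xs ys = trans (cong sum (map-++ _ xs ys)) (sum-++ (map _ xs) _)

    count-none : (∀ x → ¬ P x) → ∀ xs → count xs ≡ 0
    count-none ¬P []       = refl
    count-none ¬P (x ∷ xs) with P? x
    ... | yes p = ⊥-elim (¬P x p)
    ... | no  _ = count-none ¬P xs

  module _ {A : Set} {P Q : A → Set} (P? : Decidable P) (Q? : Decidable Q) where

    count-mono : P ⊆ Q → ∀ xs → count P? xs ≤ count Q? xs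
    count-mono P⊆Q []       = z≤n
    count-mono P⊆Q (x ∷ xs) with P? x | Q? x
    ... | yes p | no ¬q = ⊥-elim (¬q (P⊆Q p))
    ... | yes _ | yes _ = s≤s (count-mono P⊆Q xs)
    ... | no  _ | yes _ = m≤n⇒m≤1+n (count-mono P⊆Q xs)
    ... | no  _ | no  _ = count-mono P⊆Q xs

    length≤count+count : (∀ x → ¬ P x → Q x) → ∀ xs → length xs ≤ count P? xs + count Q? xs
    length≤count+count P∪Q []       = z≤n
    length≤count+count P∪Q (x ∷ xs) with P? x | Q? x
    ... | no ¬p | no ¬q = ⊥-elim (¬q (P∪Q x ¬p))
    ... | yes _ | _     = s≤s (≤-trans (length≤count+count P∪Q xs) (+-monoʳ-≤ (count P? xs) (m≤n+m _ _)))
    ... | no  _ | yes _ = subst (suc (length xs) ≤_) (sym (+-suc _ _)) (s≤s (length≤count+count P∪Q xs))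

  count≤∑count : ∀ {A D : Set} {P : A → Set} {Q : D → A → Set}
                 (P? : Decidable P) (Q? : ∀ d → Decidable (Q d)) (ds : List D) →
                 (∀ {x} → P x → ∃[ d ] d ∈ ds × Q d x) →
                 ∀ xs → count P? xs ≤ sum (map (λ d → count (Q? d) xs) ds)
  count≤∑count P? Q? ds cover []       = z≤n
  count≤∑count P? Q? ds cover (x ∷ xs) = begin
    indicator (P? x) + count P? xs
      ≤⟨ +-mono-≤ head (count≤∑count P? Q? ds cover xs) ⟩
    sum (map (λ d → indicator (Q? d x)) ds) + sum (map (λ d → count (Q? d) xs) ds)
      ≡⟨ sum-map-+ (λ d → indicator (Q? d x)) (λ d → count (Q? d) xs) ds ⟨
    sum (map (λ d → count (Q? d) (x ∷ xs)) ds) ∎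
    where
    open ≤-Reasoning
    head : indicator (P? x) ≤ sum (map (λ d → indicator (Q? d x)) ds)
    head with P? x
    ... | no  _ = z≤n
    ... | yes p with d , d∈ds , q ← cover p =
      ≤-trans (1≤indicator (Q? d x) q) (∈⇒≤sum-map (λ d → indicator (Q? d x)) d∈ds)

  count-range-suc : ∀ {P : ℕ → Set} (P? : Decidable P) a L →
                    count P? (range a (suc L)) ≡ count P? (range a L) + indicator (P? (a + L))
  count-range-suc P? a L = begin
    count P? (range a (suc L))                           ≡⟨ cong (count P?) (range-∷ʳ a L) ⟩
    count P? (range a L ++ [ a + L ])                    ≡⟨ count-++ P? (range a L) _ ⟩
    count P? (range a L) + (indicator (P? (a + L)) + 0)  ≡⟨ cong (count P? (range a L) +_) (+-identityʳ _) ⟩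
    count P? (range a L) + indicator (P? (a + L))        ∎
    where open ≡-Reasoning

  count-multiples-bounds : ∀ d .{{_ : NonZero d}} n → let c = count (d ∣?_) (range 1 n) in
                           c * d ≤ n × n < suc c * d
  count-multiples-bounds d zero    = z≤n , <-≤-trans (>-nonZero⁻¹ d) (m≤m+n d 0)
  count-multiples-bounds d (suc n) rewrite count-range-suc (d ∣?_) 1 n
    with count (d ∣?_) (range 1 n) | count-multiples-bounds d n | d ∣? suc n
  ... | c | cd≤n , n<[1+c]d | yes (divides q 1+n≡qd) =
    subst (λ c′ → c′ * d ≤ suc n × suc n < suc c′ * d) (+-comm 1 c)
          (≤-reflexive [1+c]d≡1+n , subst (_< d + suc c * d) [1+c]d≡1+n (m<n+m _ (>-nonZero⁻¹ d)))
    where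
    c<q : c < q
    c<q = *-cancelʳ-< d c q (<-≤-trans (s≤s cd≤n) (≤-reflexive 1+n≡qd))
    [1+c]d≡1+n : suc c * d ≡ suc n
    [1+c]d≡1+n = ≤-antisym (≤-trans (*-monoˡ-≤ d c<q) (≤-reflexive (sym 1+n≡qd))) n<[1+c]d
  ... | c | cd≤n , n<[1+c]d | no d∤1+n rewrite +-identityʳ c =
    m≤n⇒m≤1+n cd≤n , ≤∧≢⇒< n<[1+c]d (λ 1+n≡[1+c]d → d∤1+n (divides (suc c) 1+n≡[1+c]d))

  count-multiples-in-range : ∀ d .{{_ : NonZero d}} a L → count (d ∣?_) (range (suc a) L) * d < L + d
  count-multiples-in-range d a L = +-cancelʳ-≤ a (suc (C * d)) (L + d) (begin
    suc (C * d) + a       ≡⟨ +-suc (C * d) a ⟨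
    C * d + suc a         ≤⟨ +-monoʳ-≤ (C * d) (proj₂ (count-multiples-bounds d a)) ⟩
    C * d + (d + c₀ * d)  ≡⟨ solve 3 (λ C c₀ d → C :* d :+ (d :+ c₀ :* d) := (c₀ :+ C) :* d :+ d)
                                     refl C c₀ d ⟩
    (c₀ + C) * d + d      ≤⟨ +-monoˡ-≤ d [c₀+C]d≤a+L ⟩
    a + L + d             ≡⟨ solve 3 (λ a L d → a :+ L :+ d := L :+ d :+ a) refl a L d ⟩
    L + d + a             ∎)
    where
    open ≤-Reasoning
    open ℕ-Solver
    c₀ = count (d ∣?_) (range 1 a)
    C  = count (d ∣?_) (range (suc a) L)
    [c₀+C]d≤a+L : (c₀ + C) * d ≤ a + L
    [c₀+C]d≤a+L = subst (λ c → c * d ≤ a + L)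
      (trans (cong (count (d ∣?_)) (range-++ 1 a L)) (count-++ (d ∣?_) (range 1 a) _))
      (proj₁ (count-multiples-bounds d (a + L)))

  count-common-multiples : ∀ d .{{_ : NonZero d}} n →
                           count (λ m → d ∣? m ×-dec d ∣? n) (range 1 n) * d ≤ indicator (d ∣? n) * n
  count-common-multiples d n with d ∣? n
  ... | yes d∣n = begin
    count (λ m → d ∣? m ×-dec yes d∣n) (range 1 n) * d  ≤⟨ *-monoˡ-≤ d (count-mono _ _ proj₁ (range 1 n)) ⟩
    count (d ∣?_) (range 1 n) * d                       ≤⟨ proj₁ (count-multiples-bounds d n) ⟩
    n                                                   ≡⟨ +-identityʳ n ⟨
    1 * n                                               ∎
    where open ≤-Reasoning
  ... | no d∤n = ≤-reflexive (cong (_* d) (count-none _ (λ _ → d∤n ∘ proj₂) (range 1 n)))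

  φ-as-count : ∀ k n → φ k n ≡ count (λ m → gcd m n ≤? k) (range 1 n)
  φ-as-count k n = trans (cong (λ ms → length (filter (λ m → gcd m n ≤? k) ms)) (map-+-upTo 1 n))
                         (length-filter≡count _ (range 1 n))

  φ≤n : ∀ k n → φ k n ≤ n
  φ≤n k n = ≤-trans (length-filter _ (map suc (upTo n)))
                    (≤-reflexive (trans (length-map suc (upTo n)) (length-upTo n)))

  n∸φ≤∑count-common-multiples : ∀ k N n .{{_ : NonZero n}} → n ≤ N →
    n ∸ φ k n ≤ sum (map (λ d → count (λ m → d ∣? m ×-dec d ∣? n) (range 1 n)) (range (suc k) (N ∸ k)))
  n∸φ≤∑count-common-multiples k N n n≤N = m≤n+o⇒m∸n≤o n (φ k n) (begin
    n                    ≡⟨ length-range 1 n ⟨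
    length (range 1 n)   ≤⟨ length≤count+count _ _ (λ _ → ≰⇒>) (range 1 n) ⟩
    #gcd≤k + #k<gcd      ≡⟨ cong (_+ #k<gcd) (φ-as-count k n) ⟨
    φ k n + #k<gcd       ≤⟨ +-monoʳ-≤ (φ k n) (count≤∑count _ _ _ cover (range 1 n)) ⟩
    φ k n + _            ∎)
    where
    open ≤-Reasoning
    #gcd≤k = count (λ m → gcd m n ≤? k) (range 1 n)
    #k<gcd = count (λ m → k <? gcd m n) (range 1 n)
    cover : ∀ {m} → k < gcd m n → ∃[ d ] d ∈ range (suc k) (N ∸ k) × (d ∣ m × d ∣ n)
    cover {m} k<g = gcd m n , ∈-range⁺ k<g g<1+k+[N∸k] , gcd[m,n]∣m m n , gcd[m,n]∣n m n
      where
      g≤N : gcd m n ≤ N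
      g≤N = ≤-trans (gcd[m,n]≤n m n) n≤N
      g<1+k+[N∸k] : gcd m n < suc k + (N ∸ k)
      g<1+k+[N∸k] = s≤s (subst (gcd m n ≤_) (sym (m+[n∸m]≡n (<⇒≤ (<-≤-trans k<g g≤N)))) g≤N)

open Counting

open import Data.Integer.Base as ℤ using (+≤+)
import Data.Integer.Properties as ℤ
open import Data.Integer.Solver renaming (module +-*-Solver to ℤ-Solver)
open import Data.Nat.Base as ℕ using (ℕ; zero; suc; z≤n; s≤s; _∸_)
import Data.Nat.Properties as ℕ
open import Data.Rational.Base as ℚ using (ℚ; 0ℚ; 1ℚ; _+_; _-_; _*_; _≤_; toℚᵘ; nonNegative)
import Data.Rational.Properties as ℚ
open import Data.Rational.Solver renaming (module +-*-Solver to ℚ-Solver)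
open import Data.Rational.Unnormalised.Base as ℚᵘ using (mkℚᵘ; *≡*; *≤*)
import Data.Rational.Unnormalised.Properties as ℚᵘ

toℚᵘ-/ℕ : ∀ a n → toℚᵘ (a /ℕ suc n) ℚᵘ.≃ mkℚᵘ (ℤ.+ a) n
toℚᵘ-/ℕ a n = ℚ.toℚᵘ-fromℚᵘ (mkℚᵘ (ℤ.+ a) n)

/ℕ-≡ : ∀ a b m n → a ℕ.* suc m ≡ b ℕ.* suc n → a /ℕ suc n ≡ b /ℕ suc m
/ℕ-≡ a b m n a[1+m]≡b[1+n] = ℚ.fromℚᵘ-cong {mkℚᵘ (ℤ.+ a) n} {mkℚᵘ (ℤ.+ b) m} (*≡* (begin
  ℤ.+ a ℤ.* ℤ.+ suc m  ≡⟨ ℤ.pos-* a (suc m) ⟨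
  ℤ.+ (a ℕ.* suc m)    ≡⟨ cong ℤ.+_ a[1+m]≡b[1+n] ⟩
  ℤ.+ (b ℕ.* suc n)    ≡⟨ ℤ.pos-* b (suc n) ⟩
  ℤ.+ b ℤ.* ℤ.+ suc n  ∎))
  where open ≡-Reasoning

/ℕ-≤ : ∀ a b m n → a ℕ.* suc m ℕ.≤ b ℕ.* suc n → a /ℕ suc n ≤ b /ℕ suc m
/ℕ-≤ a b m n a[1+m]≤b[1+n] = ℚ.toℚᵘ-cancel-≤
  (ℚᵘ.≤-respʳ-≃ (ℚᵘ.≃-sym (toℚᵘ-/ℕ b m)) (ℚᵘ.≤-respˡ-≃ (ℚᵘ.≃-sym (toℚᵘ-/ℕ a n))
    (*≤* (subst₂ ℤ._≤_ (ℤ.pos-* a (suc m)) (ℤ.pos-* b (suc n)) (+≤+ a[1+m]≤b[1+n])))))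

/ℕ-+ : ∀ a b n → a /ℕ suc n + b /ℕ suc n ≡ (a ℕ.+ b) /ℕ suc n
/ℕ-+ a b n = ℚ.toℚᵘ-injective (begin
  toℚᵘ (a /ℕ suc n + b /ℕ suc n)            ≈⟨ ℚ.toℚᵘ-homo-+ (a /ℕ suc n) (b /ℕ suc n) ⟩
  toℚᵘ (a /ℕ suc n) ℚᵘ.+ toℚᵘ (b /ℕ suc n)  ≈⟨ ℚᵘ.+-cong (toℚᵘ-/ℕ a n) (toℚᵘ-/ℕ b n) ⟩
  mkℚᵘ (ℤ.+ a) n ℚᵘ.+ mkℚᵘ (ℤ.+ b) n        ≈⟨ *≡* cross ⟩
  mkℚᵘ (ℤ.+ (a ℕ.+ b)) n                    ≈⟨ toℚᵘ-/ℕ (a ℕ.+ b) n ⟨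
  toℚᵘ ((a ℕ.+ b) /ℕ suc n)                 ∎)
  where
  open ℚᵘ.≃-Reasoning
  open ℤ-Solver
  s = ℤ.+ suc n
  cross : (ℤ.+ a ℤ.* s ℤ.+ ℤ.+ b ℤ.* s) ℤ.* s ≡ ℤ.+ (a ℕ.+ b) ℤ.* (s ℤ.* s)
  cross = trans (solve 3 (λ a b s → (a :* s :+ b :* s) :* s := (a :+ b) :* (s :* s)) refl (ℤ.+ a) (ℤ.+ b) s)
                (cong (ℤ._* (s ℤ.* s)) (ℤ.pos-+ a b))

/ℕ-* : ∀ a b m n → a /ℕ suc m * b /ℕ suc n ≡ (a ℕ.* b) /ℕ (suc m ℕ.* suc n)
/ℕ-* a b m n = ℚ.toℚᵘ-injective (begin
  toℚᵘ (a /ℕ suc m * b /ℕ suc n)            ≈⟨ ℚ.toℚᵘ-homo-* (a /ℕ suc m) (b /ℕ suc n) ⟩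
  toℚᵘ (a /ℕ suc m) ℚᵘ.* toℚᵘ (b /ℕ suc n)  ≈⟨ ℚᵘ.*-cong (toℚᵘ-/ℕ a m) (toℚᵘ-/ℕ b n) ⟩
  mkℚᵘ (ℤ.+ a) m ℚᵘ.* mkℚᵘ (ℤ.+ b) n        ≡⟨ cong (λ z → mkℚᵘ z _) (ℤ.pos-* a b) ⟨
  mkℚᵘ (ℤ.+ (a ℕ.* b)) (n ℕ.+ m ℕ.* suc n)  ≈⟨ toℚᵘ-/ℕ (a ℕ.* b) _ ⟨
  toℚᵘ ((a ℕ.* b) /ℕ (suc m ℕ.* suc n))     ∎)
  where open ℚᵘ.≃-Reasoning

0≤/ℕ : ∀ a n → 0ℚ ≤ a /ℕ n
0≤/ℕ a zero    = ℚ.≤-refl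
0≤/ℕ a (suc n) = /ℕ-≤ 0 a n 0 z≤n

ℕ→ℚ-suc : ∀ j → ℕ→ℚ (suc j) ≡ 1ℚ + ℕ→ℚ j
ℕ→ℚ-suc j = sym (/ℕ-+ 1 j 0)

n*[1/n]≡1 : ∀ n → ℕ→ℚ (suc n) * 1 /ℕ suc n ≡ 1ℚ
n*[1/n]≡1 n = trans (/ℕ-* (suc n) 1 0 n) (/ℕ-≡ (suc n ℕ.* 1) 1 0 (ℕ.pred (1 ℕ.* suc n)) cross)
  where
  open ℕ-Solver
  cross : suc n ℕ.* 1 ℕ.* 1 ≡ 1 ℕ.* (1 ℕ.* suc n)
  cross = solve 1 (λ n → n :* con 1 :* con 1 := con 1 :* (con 1 :* n)) refl (suc n)

p≤q+p : ∀ {p q} → 0ℚ ≤ q → p ≤ q + p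
p≤q+p {p} {q} 0≤q = subst (_≤ q + p) (ℚ.+-identityˡ p) (ℚ.+-monoˡ-≤ p 0≤q)

p-q≤p : ∀ {p q} → 0ℚ ≤ q → p - q ≤ p
p-q≤p {p} 0≤q = subst (p - _ ≤_) (ℚ.+-identityʳ p) (ℚ.+-monoʳ-≤ p (ℚ.neg-antimono-≤ 0≤q))

0≤p*q : ∀ {p q} → 0ℚ ≤ p → 0ℚ ≤ q → 0ℚ ≤ p * q
0≤p*q {p} {q} 0≤p 0≤q = subst (_≤ p * q) (ℚ.*-zeroʳ p) (ℚ.*-monoˡ-≤-nonNeg p {{nonNegative 0≤p}} 0≤q)

∑ : List ℕ → (ℕ → ℚ) → ℚ
∑ xs f = sumℚ (map f xs)

infixl 10 ∑
syntax ∑ xs (λ x → e) = ∑[ x ∈ xs ] e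

module _ {f g : ℕ → ℚ} where

  ∑-cong : ∀ {xs} → All (λ x → f x ≡ g x) xs → ∑ xs f ≡ ∑ xs g
  ∑-cong All.[]             = refl
  ∑-cong (fx≡gx All.∷ eqs) = cong₂ _+_ fx≡gx (∑-cong eqs)

  ∑-mono : ∀ {xs} → All (λ x → f x ≤ g x) xs → ∑ xs f ≤ ∑ xs g
  ∑-mono All.[]             = ℚ.≤-refl
  ∑-mono (fx≤gx All.∷ les) = ℚ.+-mono-≤ fx≤gx (∑-mono les)

  ∑-+ : ∀ xs → ∑[ x ∈ xs ] (f x + g x) ≡ ∑ xs f + ∑ xs g
  ∑-+ []       = refl
  ∑-+ (x ∷ xs) = trans (cong ((f x + g x) +_) (∑-+ xs))
    (solve 4 (λ a b c d → (a :+ b) :+ (c :+ d) := (a :+ c) :+ (b :+ d)) refl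
             (f x) (g x) (∑ xs f) (∑ xs g))
    where open ℚ-Solver

  ∑-sub : ∀ xs → ∑[ x ∈ xs ] (f x - g x) ≡ ∑ xs f - ∑ xs g
  ∑-sub []       = refl
  ∑-sub (x ∷ xs) = trans (cong ((f x - g x) +_) (∑-sub xs))
    (solve 4 (λ a b c d → (a :- b) :+ (c :- d) := (a :+ c) :- (b :+ d)) refl
             (f x) (g x) (∑ xs f) (∑ xs g))
    where open ℚ-Solver

∑-++ : ∀ (f : ℕ → ℚ) xs ys → ∑ (xs ++ ys) f ≡ ∑ xs f + ∑ ys f
∑-++ f []       ys = sym (ℚ.+-identityˡ _)
∑-++ f (x ∷ xs) ys = trans (cong (f x +_) (∑-++ f xs ys)) (sym (ℚ.+-assoc (f x) _ _))

∑-0 : ∀ xs → ∑[ _ ∈ xs ] 0ℚ ≡ 0ℚ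
∑-0 []       = refl
∑-0 (x ∷ xs) = trans (ℚ.+-identityˡ _) (∑-0 xs)

∑-nonNeg : ∀ {f : ℕ → ℚ} {xs} → All (λ x → 0ℚ ≤ f x) xs → 0ℚ ≤ ∑ xs f
∑-nonNeg {f} {xs} 0≤f = subst (_≤ ∑ xs f) (∑-0 xs) (∑-mono 0≤f)

∑-swap : ∀ (F : ℕ → ℕ → ℚ) xs ys →
         ∑[ x ∈ xs ] ∑[ y ∈ ys ] F x y ≡ ∑[ y ∈ ys ] ∑[ x ∈ xs ] F x y
∑-swap F []       ys = sym (∑-0 ys)
∑-swap F (x ∷ xs) ys = trans (cong (∑ ys (F x) +_) (∑-swap F xs ys)) (sym (∑-+ ys))

∑-/ℕ : ∀ (f : ℕ → ℕ) d xs → ∑[ x ∈ xs ] (f x /ℕ suc d) ≡ sum (map f xs) /ℕ suc d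
∑-/ℕ f d []       = sym (ℚ.0/n≡0 (suc d))
∑-/ℕ f d (x ∷ xs) = trans (cong (f x /ℕ suc d +_) (∑-/ℕ f d xs)) (/ℕ-+ (f x) _ d)

∑-1/ℕ : ∀ d xs → ∑[ _ ∈ xs ] (1 /ℕ suc d) ≡ length xs /ℕ suc d
∑-1/ℕ d []       = sym (ℚ.0/n≡0 (suc d))
∑-1/ℕ d (x ∷ xs) = trans (cong (1 /ℕ suc d +_) (∑-1/ℕ d xs)) (/ℕ-+ 1 (length xs) d)

∑-range-suffix : ∀ {f : ℕ → ℚ} → (∀ x → 0ℚ ≤ f x) → ∀ {a b} c → a ℕ.≤ b →
                 ∑ (range b (c ∸ b)) f ≤ ∑ (range a (c ∸ a)) f
∑-range-suffix {f} 0≤f {a} {b} c a≤b with b ℕ.≤? c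
... | no  b≰c rewrite ℕ.m≤n⇒m∸n≡0 (ℕ.<⇒≤ (ℕ.≰⇒> b≰c)) =
  ∑-nonNeg (All.universal 0≤f (range a (c ∸ a)))
... | yes b≤c = begin
  ∑ (range b (c ∸ b)) f                          ≤⟨ p≤q+p (∑-nonNeg (All.universal 0≤f (range a (b ∸ a)))) ⟩
  ∑ (range a (b ∸ a)) f + ∑ (range b (c ∸ b)) f  ≡⟨ ∑-++ f (range a (b ∸ a)) _ ⟨
  ∑ (range a (b ∸ a) ++ range b (c ∸ b)) f       ≡⟨ cong (λ r → ∑ r f) (range-∸-split a≤b b≤c) ⟨
  ∑ (range a (c ∸ a)) f                          ∎
  where open ℚ.≤-Reasoning

K/[2+a]²+K/[2+a]≤K/[1+a] : ∀ K a → K /ℕ (suc (suc a) ℕ.* suc (suc a)) + K /ℕ suc (suc a) ≤ K /ℕ suc a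
K/[2+a]²+K/[2+a]≤K/[1+a] K a = begin
  K /ℕ (b ℕ.* b) + K /ℕ b                   ≡⟨ cong (K /ℕ (b ℕ.* b) +_) K/b≡Kb/b² ⟩
  K /ℕ (b ℕ.* b) + (K ℕ.* b) /ℕ (b ℕ.* b)  ≡⟨ /ℕ-+ K (K ℕ.* b) _ ⟩
  (K ℕ.+ K ℕ.* b) /ℕ (b ℕ.* b)              ≤⟨ /ℕ-≤ (K ℕ.+ K ℕ.* b) K a (ℕ.pred (b ℕ.* b))
                                                     (ℕ.m+n≤o⇒m≤o _ (ℕ.≤-reflexive cross)) ⟩
  K /ℕ suc a                                ∎
  where
  open ℚ.≤-Reasoning
  open ℕ-Solver
  b = suc (suc a)
  K/b≡Kb/b² : K /ℕ b ≡ (K ℕ.* b) /ℕ (b ℕ.* b)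
  K/b≡Kb/b² = /ℕ-≡ K (K ℕ.* b) (ℕ.pred (b ℕ.* b)) (suc a) (sym (ℕ.*-assoc K b b))
  cross : (K ℕ.+ K ℕ.* b) ℕ.* suc a ℕ.+ K ≡ K ℕ.* (b ℕ.* b)
  cross = solve 2 (λ K a → (K :+ K :* (con 2 :+ a)) :* (con 1 :+ a) :+ K := K :* ((con 2 :+ a) :* (con 2 :+ a)))
                  refl K a

∑-K/d²≤K/[1+a] : ∀ K a L → ∑[ d ∈ range (suc (suc a)) L ] K /ℕ (d ℕ.* d) ≤ K /ℕ suc a
∑-K/d²≤K/[1+a] K a L = ℚ.≤-trans (p≤q+p (0≤/ℕ K (suc a ℕ.+ L))) (telescope a L)
  where
  open ℚ.≤-Reasoning
  S : ℕ → ℕ → ℚ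
  S a L = ∑[ d ∈ range a L ] K /ℕ (d ℕ.* d)
  telescope : ∀ a L → K /ℕ suc (a ℕ.+ L) + S (suc (suc a)) L ≤ K /ℕ suc a
  telescope a zero    = ℚ.≤-reflexive (trans (ℚ.+-identityʳ _) (cong (λ n → K /ℕ suc n) (ℕ.+-identityʳ a)))
  telescope a (suc L) = begin
    K /ℕ suc (a ℕ.+ suc L) + (K/b² + T)  ≡⟨ cong (λ n → K /ℕ suc n + (K/b² + T)) (ℕ.+-suc a L) ⟩
    r + (K/b² + T)                       ≡⟨ solve 3 (λ r q t → r :+ (q :+ t) := q :+ (r :+ t)) refl r K/b² T ⟩
    K/b² + (r + T)                       ≤⟨ ℚ.+-monoʳ-≤ K/b² (telescope (suc a) L) ⟩
    K/b² + K /ℕ b                        ≤⟨ K/[2+a]²+K/[2+a]≤K/[1+a] K a ⟩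
    K /ℕ suc a                           ∎
    where
    open ℚ-Solver
    b = suc (suc a)
    K/b² = K /ℕ (b ℕ.* b)
    T = S (suc b) L
    r = K /ℕ suc (suc a ℕ.+ L)

∑-divisible≤K/d²+1/d : ∀ d a K →
  ∑[ n ∈ range (suc a) (suc K) ] indicator (suc d ∣? n) /ℕ suc d ≤ K /ℕ (suc d ℕ.* suc d) + 1 /ℕ suc d
∑-divisible≤K/d²+1/d d a K = begin
  ∑[ n ∈ ns ] indicator (suc d ∣? n) /ℕ suc d  ≡⟨ ∑-/ℕ (λ n → indicator (suc d ∣? n)) d ns ⟩
  C /ℕ suc d                                   ≤⟨ /ℕ-≤ C (K ℕ.+ suc d) (ℕ.pred (suc d ℕ.* suc d)) d Cd²≤[K+d]d ⟩
  (K ℕ.+ suc d) /ℕ (suc d ℕ.* suc d)           ≡⟨ /ℕ-+ K (suc d) _ ⟨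
  K /ℕ (suc d ℕ.* suc d) + suc d /ℕ (suc d ℕ.* suc d)
                                               ≡⟨ cong (K /ℕ (suc d ℕ.* suc d) +_)
                                                       (/ℕ-≡ (suc d) 1 d _ (sym (ℕ.*-identityˡ _))) ⟩
  K /ℕ (suc d ℕ.* suc d) + 1 /ℕ suc d          ∎
  where
  open ℚ.≤-Reasoning
  ns = range (suc a) (suc K)
  C = count (suc d ∣?_) ns
  Cd²≤[K+d]d : C ℕ.* (suc d ℕ.* suc d) ℕ.≤ (K ℕ.+ suc d) ℕ.* suc d
  Cd²≤[K+d]d = ℕ.≤-trans (ℕ.≤-reflexive (sym (ℕ.*-assoc C (suc d) (suc d))))
                         (ℕ.*-monoˡ-≤ (suc d) (ℕ.≤-pred (count-multiples-in-range (suc d) a (suc K))))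

deficit : ℕ → ℕ → ℚ
deficit k n = (n ∸ φ k n) /ℕ n

0≤deficit : ∀ k n → 0ℚ ≤ deficit k n
0≤deficit k n = 0≤/ℕ (n ∸ φ k n) n

φ/n+deficit≡1 : ∀ k n → φ k (suc n) /ℕ suc n + deficit k (suc n) ≡ 1ℚ
φ/n+deficit≡1 k n = trans (/ℕ-+ φ′ (suc n ∸ φ′) n) (/ℕ-≡ (φ′ ℕ.+ (suc n ∸ φ′)) 1 0 n (begin
  (φ′ ℕ.+ (suc n ∸ φ′)) ℕ.* 1  ≡⟨ ℕ.*-identityʳ _ ⟩
  φ′ ℕ.+ (suc n ∸ φ′)          ≡⟨ ℕ.m+[n∸m]≡n (φ≤n k (suc n)) ⟩
  suc n                        ≡⟨ ℕ.*-identityˡ (suc n) ⟨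
  1 ℕ.* suc n                  ∎))
  where
  open ≡-Reasoning
  φ′ = φ k (suc n)

deficit≤∑1/divisor : ∀ k N n → suc n ℕ.≤ N →
  deficit k (suc n) ≤ ∑[ d ∈ range (suc k) (N ∸ k) ] indicator (d ∣? suc n) /ℕ d
deficit≤∑1/divisor k N n 1+n≤N = begin
  (suc n ∸ φ k (suc n)) /ℕ suc n          ≤⟨ /ℕ-≤ (suc n ∸ φ k (suc n)) (sum (map c D)) n n
                                                   (ℕ.*-monoˡ-≤ (suc n) (n∸φ≤∑count-common-multiples k N (suc n) 1+n≤N)) ⟩
  sum (map c D) /ℕ suc n                  ≡⟨ ∑-/ℕ c n D ⟨
  ∑[ d ∈ D ] c d /ℕ suc n                 ≤⟨ ∑-mono (All-range (suc k) (N ∸ k) c/n≤[d∣n]/d) ⟩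
  ∑[ d ∈ D ] indicator (d ∣? suc n) /ℕ d  ∎
  where
  open ℚ.≤-Reasoning
  D = range (suc k) (N ∸ k)
  c : ℕ → ℕ
  c d = count (λ m → d ∣? m ×-dec d ∣? suc n) (range 1 (suc n))
  c/n≤[d∣n]/d : ∀ d → suc k ℕ.≤ d → d ℕ.< suc k ℕ.+ (N ∸ k) →
                c d /ℕ suc n ≤ indicator (d ∣? suc n) /ℕ d
  c/n≤[d∣n]/d (suc d) _ _ =
    /ℕ-≤ (c (suc d)) (indicator (suc d ∣? suc n)) d n (count-common-multiples (suc d) (suc n))

∑-deficit≤ : ∀ k M N → M ℕ.< N →
  ∑[ n ∈ range (suc M) (suc (N ∸ suc M)) ] deficit (suc k) n
    ≤ (N ∸ suc M) /ℕ suc k + ∑[ d ∈ range 2 (N ∸ 1) ] 1 /ℕ d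
∑-deficit≤ k M N M<N = begin
  ∑[ n ∈ A ] deficit (suc k) n                   ≤⟨ ∑-mono (All-range (suc M) (suc K) deficit≤) ⟩
  ∑[ n ∈ A ] ∑[ d ∈ D ] indicator (d ∣? n) /ℕ d  ≡⟨ ∑-swap (λ n d → indicator (d ∣? n) /ℕ d) A D ⟩
  ∑[ d ∈ D ] ∑[ n ∈ A ] indicator (d ∣? n) /ℕ d  ≤⟨ ∑-mono (All-range (suc (suc k)) (N ∸ suc k) ∑-divisible≤) ⟩
  ∑[ d ∈ D ] (K /ℕ (d ℕ.* d) + 1 /ℕ d)           ≡⟨ ∑-+ D ⟩
  ∑[ d ∈ D ] K /ℕ (d ℕ.* d) + ∑[ d ∈ D ] 1 /ℕ d  ≤⟨ ℚ.+-mono-≤ (∑-K/d²≤K/[1+a] K k (N ∸ suc k))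
                                                                (∑-range-suffix (0≤/ℕ 1) (suc N) (s≤s (s≤s z≤n))) ⟩
  K /ℕ suc k + ∑[ d ∈ range 2 (N ∸ 1) ] 1 /ℕ d   ∎
  where
  open ℚ.≤-Reasoning
  K = N ∸ suc M
  A = range (suc M) (suc K)
  -- Both D and range 2 (N ∸ 1) are definitionally of the form range b (suc N ∸ b),
  -- which is what lets ∑-range-suffix compare them.
  D = range (suc (suc k)) (N ∸ suc k)
  deficit≤ : ∀ n → suc M ℕ.≤ n → n ℕ.< suc M ℕ.+ suc K →
             deficit (suc k) n ≤ ∑[ d ∈ D ] indicator (d ∣? n) /ℕ d
  deficit≤ (suc n) _ n<M+1+K = deficit≤∑1/divisor (suc k) N n
    (ℕ.≤-pred (subst (suc n ℕ.<_) (trans (ℕ.+-suc (suc M) K) (cong suc (ℕ.m+[n∸m]≡n M<N))) n<M+1+K))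
  ∑-divisible≤ : ∀ d → suc (suc k) ℕ.≤ d → d ℕ.< suc (suc k) ℕ.+ (N ∸ suc k) →
                 ∑[ n ∈ A ] indicator (d ∣? n) /ℕ d ≤ K /ℕ (d ℕ.* d) + 1 /ℕ d
  ∑-divisible≤ (suc d) _ _ = ∑-divisible≤K/d²+1/d d M K

[N∸M+1]-phiSum≡∑deficit : ∀ k M N →
  ℕ→ℚ (N ∸ suc M ℕ.+ 1) - phiSum k (suc M) N ≡ ∑[ n ∈ range (suc M) (suc (N ∸ suc M)) ] deficit k n
[N∸M+1]-phiSum≡∑deficit k M N = begin
  ℕ→ℚ (K ℕ.+ 1) - phiSum k (suc M) N     ≡⟨ cong₂ _-_ K+1≡∑φ/n+∑deficit
                                                      (cong (λ ns → ∑ ns φ/n) (map-+-upTo (suc M) (suc K))) ⟩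
  (∑ A φ/n + ∑ A (deficit k)) - ∑ A φ/n  ≡⟨ solve 2 (λ p d → (p :+ d) :- p := d) refl (∑ A φ/n) (∑ A (deficit k)) ⟩
  ∑ A (deficit k)                        ∎
  where
  open ≡-Reasoning
  open ℚ-Solver
  K = N ∸ suc M
  A = range (suc M) (suc K)
  φ/n : ℕ → ℚ
  φ/n n = φ k n /ℕ n
  K+1≡∑φ/n+∑deficit : ℕ→ℚ (K ℕ.+ 1) ≡ ∑ A φ/n + ∑ A (deficit k)
  K+1≡∑φ/n+∑deficit = begin
    ℕ→ℚ (K ℕ.+ 1)                     ≡⟨ cong ℕ→ℚ (trans (ℕ.+-comm K 1) (sym (length-range (suc M) (suc K)))) ⟩
    ℕ→ℚ (length A)                    ≡⟨ ∑-1/ℕ 0 A ⟨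
    ∑[ _ ∈ A ] 1ℚ                     ≡⟨ ∑-cong (All-range (suc M) (suc K) 1≡φ/n+deficit) ⟩
    ∑[ n ∈ A ] (φ/n n + deficit k n)  ≡⟨ ∑-+ {φ/n} {deficit k} A ⟩
    ∑ A φ/n + ∑ A (deficit k)         ∎
    where
    1≡φ/n+deficit : ∀ n → suc M ℕ.≤ n → n ℕ.< suc M ℕ.+ suc K → 1ℚ ≡ φ/n n + deficit k n
    1≡φ/n+deficit (suc n) _ _ = sym (φ/n+deficit≡1 k n)

bernoulli : ∀ {u} → 0ℚ ≤ u → u ≤ 1ℚ → ∀ j → 1ℚ - ℕ→ℚ j * u ≤ (1ℚ - u) ^ℚ j
bernoulli {u} 0≤u u≤1 zero    = ℚ.≤-reflexive (solve 1 (λ u → con 1ℚ :- con 0ℚ :* u := con 1ℚ) refl u)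
  where open ℚ-Solver
bernoulli {u} 0≤u u≤1 (suc j) = begin
  1ℚ - ℕ→ℚ (suc j) * u                     ≡⟨ cong (λ x → 1ℚ - x * u) (ℕ→ℚ-suc j) ⟩
  1ℚ - (1ℚ + ℕ→ℚ j) * u                    ≤⟨ p≤q+p (0≤p*q (0≤p*q (0≤/ℕ j 1) 0≤u) 0≤u) ⟩
  ℕ→ℚ j * u * u + (1ℚ - (1ℚ + ℕ→ℚ j) * u)  ≡⟨ solve 2 (λ j u → j :* u :* u :+ (con 1ℚ :- (con 1ℚ :+ j) :* u)
                                                         := (con 1ℚ :- u) :* (con 1ℚ :- j :* u)) refl (ℕ→ℚ j) u ⟩
  (1ℚ - u) * (1ℚ - ℕ→ℚ j * u)              ≤⟨ ℚ.*-monoˡ-≤-nonNeg (1ℚ - u) {{nonNegative 0≤1-u}}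
                                                                  (bernoulli 0≤u u≤1 j) ⟩
  (1ℚ - u) * (1ℚ - u) ^ℚ j                 ∎
  where
  open ℚ.≤-Reasoning
  open ℚ-Solver
  0≤1-u : 0ℚ ≤ 1ℚ - u
  0≤1-u = subst (_≤ 1ℚ - u) (ℚ.+-inverseʳ u) (ℚ.+-monoˡ-≤ (ℚ.- u) u≤1)

1/[1+i]-1/N≤logTerm : ∀ N i → 1 /ℕ suc i - 1 /ℕ suc N ≤ ((1ℚ - 1 /ℕ suc N) ^ℚ suc i) * 1 /ℕ suc i
1/[1+i]-1/N≤logTerm N i = begin
  t - u                       ≡⟨ cong (t -_) (trans (sym (ℚ.*-identityʳ u)) (cong (u *_) (sym (n*[1/n]≡1 i)))) ⟩
  t - u * (ℕ→ℚ (suc i) * t)   ≡⟨ solve 3 (λ t u j → t :- u :* (j :* t) := (con 1ℚ :- j :* u) :* t)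
                                         refl t u (ℕ→ℚ (suc i)) ⟩
  (1ℚ - ℕ→ℚ (suc i) * u) * t  ≤⟨ ℚ.*-monoʳ-≤-nonNeg t {{nonNegative (0≤/ℕ 1 (suc i))}}
                                                     (bernoulli (0≤/ℕ 1 (suc N)) u≤1 (suc i)) ⟩
  ((1ℚ - u) ^ℚ suc i) * t     ∎
  where
  open ℚ.≤-Reasoning
  open ℚ-Solver
  t = 1 /ℕ suc i
  u = 1 /ℕ suc N
  u≤1 : u ≤ 1ℚ
  u≤1 = /ℕ-≤ 1 1 0 N (s≤s z≤n)

∑1/d≡∑[1/[1+i]-1/N] : ∀ N → ∑[ d ∈ range 2 N ] 1 /ℕ d ≡ ∑[ i ∈ upTo N ] (1 /ℕ suc i - 1 /ℕ suc N)
∑1/d≡∑[1/[1+i]-1/N] N = begin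
  S₂                                              ≡⟨ solve 1 (λ s → s := (con 1ℚ :+ s) :- con 1ℚ) refl S₂ ⟩
  (1ℚ + S₂) - 1ℚ                                  ≡⟨ cong₂ _-_ H₁+u≡1+S₂ v+u≡1 ⟨
  (H₁ + u) - (v + u)                              ≡⟨ solve 3 (λ h u v → (h :+ u) :- (v :+ u) := h :- v) refl H₁ u v ⟩
  H₁ - v                                          ≡⟨ cong₂ _-_ (cong sumℚ (sym (map-∘ (upTo N)))) v≡∑u ⟩
  ∑[ i ∈ upTo N ] 1 /ℕ suc i - ∑[ _ ∈ upTo N ] u  ≡⟨ ∑-sub (upTo N) ⟨
  ∑[ i ∈ upTo N ] (1 /ℕ suc i - u)                ∎
  where
  open ≡-Reasoning
  open ℚ-Solver
  u = 1 /ℕ suc N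
  v = N /ℕ suc N
  S₂ = ∑[ d ∈ range 2 N ] 1 /ℕ d
  H₁ = ∑[ d ∈ map suc (upTo N) ] 1 /ℕ d
  H₁+u≡1+S₂ : H₁ + u ≡ 1ℚ + S₂
  H₁+u≡1+S₂ = begin
    H₁ + u                                  ≡⟨ cong (λ ds → ∑ ds (1 /ℕ_) + u) (map-+-upTo 1 N) ⟩
    ∑ (range 1 N) (1 /ℕ_) + u               ≡⟨ cong (∑ (range 1 N) (1 /ℕ_) +_) (ℚ.+-identityʳ u) ⟨
    ∑ (range 1 N) (1 /ℕ_) + (u + 0ℚ)        ≡⟨ ∑-++ (1 /ℕ_) (range 1 N) [ suc N ] ⟨
    ∑ (range 1 N ++ [ suc N ]) (1 /ℕ_)      ≡⟨ cong (λ ds → ∑ ds (1 /ℕ_)) (range-∷ʳ 1 N) ⟨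
    1ℚ + S₂                                 ∎
  v+u≡1 : v + u ≡ 1ℚ
  v+u≡1 = trans (/ℕ-+ N 1 N) (/ℕ-≡ (N ℕ.+ 1) 1 0 N
                (trans (ℕ.*-identityʳ _) (trans (ℕ.+-comm N 1) (sym (ℕ.*-identityˡ (suc N))))))
  v≡∑u : v ≡ ∑[ _ ∈ upTo N ] u
  v≡∑u = sym (trans (∑-1/ℕ N (upTo N)) (cong (_/ℕ suc N) (length-upTo N)))

∑1/d≤logPartial : ∀ N → ∑[ d ∈ range 2 N ] 1 /ℕ d ≤ logPartial (suc N) N
∑1/d≤logPartial N = ℚ.≤-trans (ℚ.≤-reflexive (∑1/d≡∑[1/[1+i]-1/N] N))
                              (∑-mono (All.universal (1/[1+i]-1/N≤logTerm N) (upTo N)))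

≤log-intro : ∀ {q} N J → q ≤ logPartial N J → q ≤log N
≤log-intro N J q≤logPartial ε 0<ε = J , ℚ.≤-trans (p-q≤p (ℚ.<⇒≤ 0<ε)) q≤logPartial

lemma1 : (M N k : ℕ) → 1 ℕ.≤ M → 1 ℕ.≤ k → M ℕ.< N →
    (0ℚ ≤ ℕ→ℚ (N ∸ M ℕ.+ 1) - phiSum k M N)
    × ((ℕ→ℚ (N ∸ M ℕ.+ 1) - phiSum k M N) - ((N ∸ M) /ℕ k)) ≤log N
lemma1 (suc M) (suc N) (suc k) _ _ M<N = 0≤gap , ≤log-intro (suc N) N gap-K≤log
  where
  open ℚ.≤-Reasoning
  open ℚ-Solver
  gap = ℕ→ℚ (suc N ∸ suc M ℕ.+ 1) - phiSum (suc k) (suc M) (suc N)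
  K   = (suc N ∸ suc M) /ℕ suc k
  H   = ∑[ d ∈ range 2 N ] 1 /ℕ d
  A   = range (suc M) (suc (suc N ∸ suc M))
  gap≡∑deficit = [N∸M+1]-phiSum≡∑deficit (suc k) M (suc N)
  0≤gap : 0ℚ ≤ gap
  0≤gap = subst (0ℚ ≤_) (sym gap≡∑deficit) (∑-nonNeg (All.universal (0≤deficit (suc k)) A))
  gap-K≤log : gap - K ≤ logPartial (suc N) N
  gap-K≤log = begin
    gap - K                    ≡⟨ cong (_- K) gap≡∑deficit ⟩
    ∑ A (deficit (suc k)) - K  ≤⟨ ℚ.+-monoˡ-≤ (ℚ.- K) (∑-deficit≤ k M (suc N) (ℕ.<⇒≤ M<N)) ⟩
    (K + H) - K                ≡⟨ solve 2 (λ k h → (k :+ h) :- k := h) refl K H ⟩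
    H                          ≤⟨ ∑1/d≤logPartial N ⟩
    logPartial (suc N) N       ∎
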